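{- (1) For every integer $n\ge 2$, $A^n_{n-3}+A^n_{n-2}=C_{n-2}$. (2) For all integers $n\ge 2$ and $q\ge 2$, $\sum_{i+j=n}A^{i+1}_{i-1}A^{j+1}_{j+1-q}=A^n_{n-q}$. (3) For every integer $n\ge 3$, $\sum_{i+j=n}A^{i+1}_{i-2}A^{j+1}_{j-2}=C_{n-1}-2C_{n-2}$. (4) For every integer $n\ge 3$, $\sum_{i+j=n}A^{i+1}_{i-2}A^{j+1}_{j-3}=\frac{(n-3)(n-4)}{2n}C_{n-2}$. Here all sums are over pairs of nonnegative integers $(i,j)$ with $i+j=n$.
   Context: For real $m,l$: $A^m_l=\frac{1}{l+1}\binom{m+l-1}{l}\binom{m-3}{l}$ if $m,l$ are integers with $0\le l\le m-3$; $A^2_0=1$; $A^m_l=0$ otherwise. ($A^m_l$ is the number of dissections of a convex $m$-gon by $l$ non-crossing diagonals.) For real $m$, $C_m=\frac{1}{m+1}\binom{2m}{m}$ if $m$ is a nonnegative integer and $C_m=0$ otherwise. -}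

module Defs where

open import Data.Nat as ℕ using (ℕ; zero; suc; _≤?_; _≟_)
open import Data.Nat.Combinatorics using (_C_)
open import Data.Integer as ℤ using (ℤ; +_; -[1+_])
open import Data.Rational as ℚ using (ℚ; 0ℚ; 1ℚ; _/_)
open import Data.List using (List; foldr; map; upTo)
open import Relation.Nullary using (yes; no)

-- A^m_l : number of dissections of a convex m-gon by l non-crossing diagonals,
-- extended to all integer arguments as in the paper:
--   A^m_l = 1/(l+1) * binom(m+l-1, l) * binom(m-3, l)   if 0 ≤ l ≤ m-3,
--   A^2_0 = 1,  A^m_l = 0 otherwise.
A : ℤ → ℤ → ℚ
A (+ m) (+ l) with (l ℕ.+ 3) ≤? m
... | yes _ = (+ ((((m ℕ.+ l) ℕ.∸ 1) C l) ℕ.* ((m ℕ.∸ 3) C l))) / suc l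
... | no _ with m ≟ 2 | l ≟ 0
...   | yes _ | yes _ = 1ℚ
...   | _     | _     = 0ℚ
A (+ m) -[1+ l ] = 0ℚ
A -[1+ m ] l = 0ℚ

Cat : ℤ → ℚ
Cat (+ m) = (+ ((2 ℕ.* m) C m)) / suc m
Cat -[1+ m ] = 0ℚ

sumPairs : ℕ → (ℕ → ℕ → ℚ) → ℚ
sumPairs n f = foldr ℚ._+_ 0ℚ (map (λ i → f i (n ℕ.∸ i)) (upTo (suc n)))

-- The coefficient (n-3)(n-4)/(2n) (only used for n ≥ 3; the n = 0 clause is
-- a dummy value that avoids division by zero).
coef4 : ℕ → ℚ
coef4 zero = 0ℚ
coef4 (suc k) = ((+ (suc k) ℤ.- + 3) ℤ.* (+ (suc k) ℤ.- + 4)) / (2 ℕ.* suc k)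

module Submission where

-- The paper's values reduce to Catalan and binomial numbers:
--   A^(t+3)_t = C_(t+1),   A^(t+4)_t = binom(2t+3, t),   A^(t+3)_(t+1) = 0.
-- With these, (1) and (2) are immediate, while (3) and (4) are convolution
-- identities.  We prove them with power series over ℕ, represented by their
-- coefficient sequences: c(x) = 1 + x c(x)^2 is the Catalan series, the
-- ballot numbers G r are the coefficients of c^r, and E r k = binom(r+2k, k)
-- are the coefficients of c^r/√(1-4x).  Everything follows from
--   * c^r c^s = c^(r+s)           (conv-G, by the recursion defining G),
--   * c^r/√ = c^(r+1) + x c^(r+2)/√   (ballot, by Pascal's rule),
-- which give Segner's recurrence for (3) and the product (c-1) c^3/√ = x c^5/√
-- for (4).  Finally the natural-number identities are transported to ℚ along
-- n ↦ n/1, where the binomial closed forms of A and Cat live.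

module PowerSeries where
  open import Data.Nat using (ℕ; zero; suc; _+_; _*_; _∸_; _<_; s≤s; z≤n)
  open import Data.Nat.Properties
  open import Algebra.Properties.CommutativeSemigroup +-commutativeSemigroup
    using () renaming (interchange to +-interchange)
  open import Relation.Binary.PropositionalEquality
  open ≡-Reasoning

  S : (ℕ → ℕ) → ℕ → ℕ
  S f zero    = 0
  S f (suc m) = f 0 + S (λ i → f (suc i)) m

  conv : (ℕ → ℕ) → (ℕ → ℕ) → ℕ → ℕ
  conv f g n = S (λ i → f i * g (n ∸ i)) (suc n)

  -- Multiplication of a power series by x.  By definition,
  -- conv (shift f) g (n + 1) reduces to conv f g n.
  shift : (ℕ → ℕ) → ℕ → ℕ
  shift f zero    = 0
  shift f (suc k) = f k

  S-cong : ∀ {f g} m → (∀ i → i < m → f i ≡ g i) → S f m ≡ S g m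
  S-cong zero    eq = refl
  S-cong (suc m) eq = cong₂ _+_ (eq 0 (s≤s z≤n)) (S-cong m (λ i i<m → eq (suc i) (s≤s i<m)))

  S-+ : ∀ f g m → S (λ i → f i + g i) m ≡ S f m + S g m
  S-+ f g zero    = refl
  S-+ f g (suc m) = begin
    f 0 + g 0 + S (λ i → f (suc i) + g (suc i)) m
      ≡⟨ cong (f 0 + g 0 +_) (S-+ (λ i → f (suc i)) (λ i → g (suc i)) m) ⟩
    f 0 + g 0 + (S (λ i → f (suc i)) m + S (λ i → g (suc i)) m)
      ≡⟨ +-interchange (f 0) (g 0) _ _ ⟩
    f 0 + S (λ i → f (suc i)) m + (g 0 + S (λ i → g (suc i)) m) ∎

  S-zero : ∀ m → S (λ _ → 0) m ≡ 0
  S-zero zero    = refl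
  S-zero (suc m) = S-zero m

  S-last : ∀ f m → S f (suc m) ≡ S f m + f m
  S-last f zero    = +-comm (f 0) 0
  S-last f (suc m) = trans (cong (f 0 +_) (S-last (λ i → f (suc i)) m)) (sym (+-assoc (f 0) _ _))

  S-reverse : ∀ f m → S f (suc m) ≡ S (λ i → f (m ∸ i)) (suc m)
  S-reverse f zero    = refl
  S-reverse f (suc m) = begin
    f 0 + S (λ i → f (suc i)) (suc m)
      ≡⟨ cong (f 0 +_) (S-reverse (λ i → f (suc i)) m) ⟩
    f 0 + S (λ i → f (suc (m ∸ i))) (suc m)
      ≡⟨ +-comm (f 0) _ ⟩
    S (λ i → f (suc (m ∸ i))) (suc m) + f 0
      ≡⟨ cong₂ _+_ (S-cong (suc m) (λ i i<1+m → cong f (sym (+-∸-assoc 1 (≤-pred i<1+m)))))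
                   (cong f (sym (n∸n≡0 m))) ⟩
    S (λ i → f (suc m ∸ i)) (suc m) + f (suc m ∸ suc m)
      ≡⟨ sym (S-last (λ i → f (suc m ∸ i)) (suc m)) ⟩
    S (λ i → f (suc m ∸ i)) (suc (suc m)) ∎

  conv-comm : ∀ f g n → conv f g n ≡ conv g f n
  conv-comm f g n = trans (S-reverse (λ i → f i * g (n ∸ i)) n) (S-cong (suc n) λ i i≤n →
    trans (cong (λ j → f (n ∸ i) * g j) (m∸[m∸n]≡n (≤-pred i≤n))) (*-comm (f (n ∸ i)) (g i)))

  conv-split : ∀ f g h k n → (∀ i → f i ≡ g i + h i) → conv f k n ≡ conv g k n + conv h k n
  conv-split f g h k n f≡g+h = trans
    (S-cong (suc n) (λ i _ → trans (cong (_* k (n ∸ i)) (f≡g+h i)) (*-distribʳ-+ (k (n ∸ i)) (g i) (h i))))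
    (S-+ (λ i → g i * k (n ∸ i)) (λ i → h i * k (n ∸ i)) (suc n))

module Ballot where
  open import Data.Nat using (ℕ; zero; suc; _+_; _*_)
  open import Data.Nat.Properties using (+-identityʳ; +-comm)
  open import Relation.Binary.PropositionalEquality
  open ≡-Reasoning
  open PowerSeries

  -- Ballot numbers: G r k is the coefficient of x^k in c(x)^r, where
  -- c(x) = 1 + x c(x)^2 is the Catalan generating function.  The defining
  -- recursion is c^(r+1) = c^r + x c^(r+2).
  G : ℕ → ℕ → ℕ
  G r       zero    = 1
  G zero    (suc k) = 0
  G (suc r) (suc k) = G r (suc k) + G (suc (suc r)) k

  cat : ℕ → ℕ
  cat = G 1

  -- The Catalan sequence without its constant term, i.e. (c - 1)/x.
  cat⁺ : ℕ → ℕ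
  cat⁺ t = cat (suc t)

  G-rec : ∀ r k → G (suc r) k ≡ G r k + shift (G (suc (suc r))) k
  G-rec r zero    = refl
  G-rec r (suc k) = refl

  G-one : ∀ r → G r 1 ≡ r
  G-one zero    = refl
  G-one (suc r) = trans (cong (_+ 1) (G-one r)) (+-comm r 1)

  conv-unit : ∀ g n → conv (G 0) g n ≡ g n
  conv-unit g n = begin
    g n + 0 + S (λ _ → 0) n ≡⟨ cong₂ _+_ (+-identityʳ (g n)) (S-zero n) ⟩
    g n + 0                 ≡⟨ +-identityʳ (g n) ⟩
    g n ∎

  conv-G : ∀ r s k → conv (G r) (G s) k ≡ G (r + s) k
  conv-G zero    s k       = conv-unit (G s) k
  conv-G (suc r) s zero    = refl
  conv-G (suc r) s (suc k) = begin
    conv (G (suc r)) (G s) (suc k)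
      ≡⟨ conv-split (G (suc r)) (G r) (shift (G (suc (suc r)))) (G s) (suc k) (G-rec r) ⟩
    conv (G r) (G s) (suc k) + conv (G (suc (suc r))) (G s) k
      ≡⟨ cong₂ _+_ (conv-G r s (suc k)) (conv-G (suc (suc r)) s k) ⟩
    G (r + s) (suc k) + G (suc (suc r) + s) k
      ≡⟨⟩
    G (suc r + s) (suc k) ∎

  segner : ∀ n → conv cat cat n ≡ cat (suc n)
  segner n = conv-G 1 1 n

module Binomials where
  open import Data.Nat using (ℕ; zero; suc; _+_; _*_; s≤s)
  open import Data.Nat.Properties
  open import Algebra.Properties.CommutativeSemigroup +-commutativeSemigroup
    using () renaming (interchange to +-interchange)
  open import Data.Nat.Combinatorics
    using (_C_; nCk≡nC[n∸k]; nC1≡n; k>n⇒nCk≡0) renaming (nCk+nC[k+1]≡[n+1]C[k+1] to pascal)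
  open import Data.Nat.Tactic.RingSolver using (solve-∀)
  open import Relation.Binary.PropositionalEquality
  open ≡-Reasoning
  open PowerSeries
  open Ballot

  symmetry : ∀ a b → (a + b) C a ≡ (a + b) C b
  symmetry a b = trans (nCk≡nC[n∸k] (m≤m+n a b)) (cong ((a + b) C_) (m+n∸m≡n a b))

  absorption : ∀ n k → (suc n C suc k) * suc k ≡ suc n * (n C k)
  absorption zero    zero    = refl
  absorption zero    (suc k) = refl
  absorption (suc n) zero    =
    trans (*-identityʳ (suc (suc n) C 1)) (trans (nC1≡n (suc (suc n))) (sym (*-identityʳ (suc (suc n)))))
  absorption (suc n) (suc k) = begin
    (suc m C suc (suc k)) * suc (suc k)
      ≡⟨ cong (_* suc (suc k)) (sym (pascal m (suc k))) ⟩
    (m C suc k + m C suc (suc k)) * suc (suc k)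
      ≡⟨ expand (m C suc k) (m C suc (suc k)) k ⟩
    (m C suc k) * suc k + (m C suc (suc k)) * suc (suc k) + m C suc k
      ≡⟨ cong₂ (λ x y → x + y + m C suc k) (absorption n k) (absorption n (suc k)) ⟩
    m * (n C k) + m * (n C suc k) + m C suc k
      ≡⟨ cong (_+ m C suc k) (sym (*-distribˡ-+ m (n C k) (n C suc k))) ⟩
    m * (n C k + n C suc k) + m C suc k
      ≡⟨ cong (λ x → m * x + m C suc k) (pascal n k) ⟩
    m * (m C suc k) + m C suc k
      ≡⟨ +-comm (m * (m C suc k)) (m C suc k) ⟩
    suc m * (m C suc k) ∎
    where
    m = suc n
    expand : ∀ a b k → (a + b) * suc (suc k) ≡ a * suc k + b * suc (suc k) + a
    expand = solve-∀

  ratio : ∀ k d → ((k + d) C k) * d ≡ ((k + d) C suc k) * suc k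
  ratio k zero = begin
    ((k + 0) C k) * 0          ≡⟨ *-zeroʳ ((k + 0) C k) ⟩
    0                          ≡⟨ cong (_* suc k) (sym (k>n⇒nCk≡0 (s≤s (≤-reflexive (+-identityʳ k))))) ⟩
    ((k + 0) C suc k) * suc k ∎
  ratio k (suc d) = begin
    ((k + suc d) C k) * suc d       ≡⟨ cong (_* suc d) (symmetry k (suc d)) ⟩
    ((k + suc d) C suc d) * suc d   ≡⟨ cong (λ n → (n C suc d) * suc d) (+-suc k d) ⟩
    (suc (k + d) C suc d) * suc d   ≡⟨ absorption (k + d) d ⟩
    suc (k + d) * ((k + d) C d)     ≡⟨ cong (suc (k + d) *_) (sym (symmetry k d)) ⟩
    suc (k + d) * ((k + d) C k)     ≡⟨ sym (absorption (k + d) k) ⟩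
    (suc (k + d) C suc k) * suc k   ≡⟨ cong (λ n → (n C suc k) * suc k) (sym (+-suc k d)) ⟩
    ((k + suc d) C suc k) * suc k ∎

  -- E r k = binom(r + 2k, k), the coefficient of x^k in c(x)^r / √(1 - 4x).
  E : ℕ → ℕ → ℕ
  E r k = (r + k + k) C k

  E-top : ∀ r k → r + suc k + suc k ≡ suc (suc (r + k + k))
  E-top = solve-∀

  E-pascal : ∀ r k → E (suc r) (suc k) ≡ E r (suc k) + E (suc (suc r)) k
  E-pascal r k = begin
    suc (r + suc k + suc k) C suc k ≡⟨ cong (λ m → suc m C suc k) (E-top r k) ⟩
    suc n C suc k                   ≡⟨ sym (pascal n k) ⟩
    n C k + n C suc k               ≡⟨ +-comm (n C k) (n C suc k) ⟩
    n C suc k + n C k               ≡⟨ cong (λ m → m C suc k + n C k) (sym (E-top r k)) ⟩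
    E r (suc k) + E (suc (suc r)) k ∎
    where n = suc (suc (r + k + k))

  central : ∀ k → E 0 (suc k) ≡ E 1 k + E 1 k
  central k = begin
    (suc k + suc k) C suc k            ≡⟨ cong (λ n → suc n C suc k) (+-suc k k) ⟩
    suc (suc k + k) C suc k            ≡⟨ sym (pascal (suc k + k) k) ⟩
    E 1 k + (suc k + k) C suc k        ≡⟨ cong (E 1 k +_) (symmetry (suc k) k) ⟩
    E 1 k + E 1 k ∎

  E-ratio : ∀ r k → E (suc (suc r)) k * suc (suc (r + k)) ≡ E r (suc k) * suc k
  E-ratio r k = begin
    E (suc (suc r)) k * d       ≡⟨ cong (λ n → (n C k) * d) (sym (top r k)) ⟩
    ((k + d) C k) * d           ≡⟨ ratio k d ⟩
    ((k + d) C suc k) * suc k   ≡⟨ cong (λ n → (n C suc k) * suc k) (trans (top r k) (sym (E-top r k))) ⟩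
    E r (suc k) * suc k ∎
    where
    d = suc (suc (r + k))
    top : ∀ r k → k + suc (suc (r + k)) ≡ suc (suc (r + k + k))
    top = solve-∀

  ballot : ∀ r k → E r (suc k) ≡ G (suc r) (suc k) + E (suc (suc r)) k
  ballot r zero = begin
    (r + 1 + 1) C 1  ≡⟨ nC1≡n (r + 1 + 1) ⟩
    r + 1 + 1        ≡⟨ +-comm (r + 1) 1 ⟩
    suc r + 1        ≡⟨ cong (_+ 1) (sym (G-one (suc r))) ⟩
    G (suc r) 1 + 1 ∎
  ballot zero (suc k) = begin
    E 0 (suc (suc k))                           ≡⟨ central (suc k) ⟩
    E 1 (suc k) + E 1 (suc k)                   ≡⟨ cong (_+ E 1 (suc k)) (ballot 1 k) ⟩
    G 2 (suc k) + E 3 k + E 1 (suc k)           ≡⟨ +-assoc (G 2 (suc k)) (E 3 k) (E 1 (suc k)) ⟩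
    G 2 (suc k) + (E 3 k + E 1 (suc k))         ≡⟨ cong (G 2 (suc k) +_) (+-comm (E 3 k) (E 1 (suc k))) ⟩
    G 2 (suc k) + (E 1 (suc k) + E 3 k)         ≡⟨ cong (G 2 (suc k) +_) (sym (E-pascal 1 k)) ⟩
    G 2 (suc k) + E 2 (suc k)                   ≡⟨⟩
    G 1 (suc (suc k)) + E 2 (suc k) ∎
  ballot (suc r) (suc k) = begin
    E (suc r) (suc (suc k))
      ≡⟨ E-pascal r (suc k) ⟩
    E r (suc (suc k)) + E (2 + r) (suc k)
      ≡⟨ cong₂ _+_ (ballot r (suc k)) (ballot (2 + r) k) ⟩
    (G (suc r) (suc (suc k)) + E (2 + r) (suc k)) + (G (3 + r) (suc k) + E (4 + r) k)
      ≡⟨ +-interchange (G (suc r) (suc (suc k))) (E (2 + r) (suc k)) (G (3 + r) (suc k)) (E (4 + r) k) ⟩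
    G (2 + r) (suc (suc k)) + (E (2 + r) (suc k) + E (4 + r) k)
      ≡⟨ cong (G (2 + r) (suc (suc k)) +_) (sym (E-pascal (2 + r) k)) ⟩
    G (2 + r) (suc (suc k)) + E (3 + r) (suc k) ∎

  catalan-binomial : ∀ j → cat (suc j) * suc (suc j) ≡ E 0 (suc j)
  catalan-binomial j = +-cancelʳ-≡ (Y * suc (suc j)) (cat (suc j) * suc (suc j)) X (begin
    cat (suc j) * suc (suc j) + Y * suc (suc j) ≡⟨ sym (*-distribʳ-+ (suc (suc j)) (cat (suc j)) Y) ⟩
    (cat (suc j) + Y) * suc (suc j)             ≡⟨ cong (_* suc (suc j)) (sym (ballot 0 j)) ⟩
    X * suc (suc j)                             ≡⟨ *-suc X (suc j) ⟩
    X + X * suc j                               ≡⟨ cong (X +_) (sym (E-ratio 0 j)) ⟩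
    X + Y * suc (suc j) ∎)
    where
    X = E 0 (suc j)
    Y = E 2 j

  conv-E : ∀ r s k → conv (E r) (G s) k ≡ E (r + s) k
  conv-E r s zero    = refl
  conv-E r s (suc k) = begin
    conv (E r) (G s) (suc k)
      ≡⟨ conv-split (E r) (G (suc r)) (shift (E (2 + r))) (G s) (suc k) ballot′ ⟩
    conv (G (suc r)) (G s) (suc k) + conv (E (2 + r)) (G s) k
      ≡⟨ cong₂ _+_ (conv-G (suc r) s (suc k)) (conv-E (2 + r) s k) ⟩
    G (suc r + s) (suc k) + E (2 + r + s) k
      ≡⟨ sym (ballot (r + s) k) ⟩
    E (r + s) (suc k) ∎
    where
    ballot′ : ∀ i → E r i ≡ G (suc r) i + shift (E (2 + r)) i
    ballot′ zero    = refl
    ballot′ (suc i) = ballot r i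

  -- ((c - 1)/x) c^r/√ = c^(r+2)/√, obtained from c · c^r/√ = c^(r+1)/√ by
  -- splitting off the constant term 1 of c.
  conv-cat⁺-E : ∀ r k → conv cat⁺ (E r) k ≡ E (2 + r) k
  conv-cat⁺-E r k = +-cancelʳ-≡ (E r (suc k)) (conv cat⁺ (E r) k) (E (2 + r) k) (begin
    conv cat⁺ (E r) k + E r (suc k)                 ≡⟨ +-comm (conv cat⁺ (E r) k) (E r (suc k)) ⟩
    E r (suc k) + conv cat⁺ (E r) k                 ≡⟨ cong (_+ conv cat⁺ (E r) k) (sym (+-identityʳ (E r (suc k)))) ⟩
    1 * E r (suc k) + conv cat⁺ (E r) k             ≡⟨⟩
    conv cat (E r) (suc k)                          ≡⟨ conv-comm cat (E r) (suc k) ⟩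
    conv (E r) (G 1) (suc k)                        ≡⟨ conv-E r 1 (suc k) ⟩
    E (r + 1) (suc k)                               ≡⟨ cong (λ r′ → E r′ (suc k)) (+-comm r 1) ⟩
    E (suc r) (suc k)                               ≡⟨ E-pascal r k ⟩
    E r (suc k) + E (2 + r) k                       ≡⟨ +-comm (E r (suc k)) (E (2 + r) k) ⟩
    E (2 + r) k + E r (suc k) ∎)

  E5-central : ∀ m → E 5 m * (2 * (5 + m) * (4 + m)) ≡ (2 + m) * (1 + m) * E 0 (3 + m)
  E5-central m = begin
    E 5 m * (2 * (5 + m) * (4 + m))            ≡⟨ regroup₁ (E 5 m) (5 + m) (4 + m) ⟩
    2 * (4 + m) * (E 5 m * (5 + m))            ≡⟨ cong (2 * (4 + m) *_) (E-ratio 3 m) ⟩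
    2 * (4 + m) * (E 3 (1 + m) * (1 + m))      ≡⟨ regroup₂ (E 3 (1 + m)) (4 + m) (1 + m) ⟩
    2 * (1 + m) * (E 3 (1 + m) * (4 + m))      ≡⟨ cong (2 * (1 + m) *_) (E-ratio 1 (1 + m)) ⟩
    2 * (1 + m) * (E 1 (2 + m) * (2 + m))      ≡⟨ regroup₃ (E 1 (2 + m)) (1 + m) (2 + m) ⟩
    (2 + m) * (1 + m) * (E 1 (2 + m) + E 1 (2 + m)) ≡⟨ cong ((2 + m) * (1 + m) *_) (sym (central (2 + m))) ⟩
    (2 + m) * (1 + m) * E 0 (3 + m) ∎
    where
    regroup₁ : ∀ x a b → x * (2 * a * b) ≡ 2 * b * (x * a)
    regroup₁ = solve-∀
    regroup₂ : ∀ x a b → 2 * a * (x * b) ≡ 2 * b * (x * a)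
    regroup₂ = solve-∀
    regroup₃ : ∀ x a b → 2 * a * (x * b) ≡ b * a * (x + x)
    regroup₃ = solve-∀

module NatToRational where
  open import Data.Nat as ℕ using (ℕ)
  open import Data.Integer as ℤ using (+_)
  import Data.Integer.Properties as ℤP
  open import Data.Rational as ℚ using (ℚ; _/_; fromℚᵘ)
  open import Data.Rational.Properties
    using (fromℚᵘ-cong; toℚᵘ-injective; toℚᵘ-homo-+; toℚᵘ-homo-*; toℚᵘ-fromℚᵘ; +-0-group)
  open import Algebra.Properties.Group +-0-group using (//-rightDividesʳ)
  open import Data.Rational.Unnormalised as ℚᵘ using (mkℚᵘ; *≡*)
  import Data.Rational.Unnormalised.Properties as ℚᵘP
  open import Relation.Binary.PropositionalEquality

  ι : ℕ → ℚ
  ι n = + n / 1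

  /-cross : ∀ a b c d → a ℕ.* ℕ.suc d ≡ c ℕ.* ℕ.suc b → + a / ℕ.suc b ≡ + c / ℕ.suc d
  /-cross a b c d eq = fromℚᵘ-cong {mkℚᵘ (+ a) b} {mkℚᵘ (+ c) d}
    (*≡* (trans (sym (ℤP.pos-* a (ℕ.suc d))) (trans (cong +_ eq) (ℤP.pos-* c (ℕ.suc b)))))

  fromℚᵘ-+ : ∀ p q → fromℚᵘ p ℚ.+ fromℚᵘ q ≡ fromℚᵘ (p ℚᵘ.+ q)
  fromℚᵘ-+ p q = toℚᵘ-injective (ℚᵘP.≃-trans (toℚᵘ-homo-+ (fromℚᵘ p) (fromℚᵘ q))
    (ℚᵘP.≃-trans (ℚᵘP.+-cong (toℚᵘ-fromℚᵘ p) (toℚᵘ-fromℚᵘ q)) (ℚᵘP.≃-sym (toℚᵘ-fromℚᵘ (p ℚᵘ.+ q)))))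

  fromℚᵘ-* : ∀ p q → fromℚᵘ p ℚ.* fromℚᵘ q ≡ fromℚᵘ (p ℚᵘ.* q)
  fromℚᵘ-* p q = toℚᵘ-injective (ℚᵘP.≃-trans (toℚᵘ-homo-* (fromℚᵘ p) (fromℚᵘ q))
    (ℚᵘP.≃-trans (ℚᵘP.*-cong (toℚᵘ-fromℚᵘ p) (toℚᵘ-fromℚᵘ q)) (ℚᵘP.≃-sym (toℚᵘ-fromℚᵘ (p ℚᵘ.* q)))))

  /-* : ∀ a b c d → (+ a / ℕ.suc b) ℚ.* (+ c / ℕ.suc d) ≡ + (a ℕ.* c) / (ℕ.suc b ℕ.* ℕ.suc d)
  /-* a b c d = trans (fromℚᵘ-* (mkℚᵘ (+ a) b) (mkℚᵘ (+ c) d))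
    (cong (_/ (ℕ.suc b ℕ.* ℕ.suc d)) (sym (ℤP.pos-* a c)))

  ι-+ : ∀ a b → ι a ℚ.+ ι b ≡ ι (a ℕ.+ b)
  ι-+ a b = trans (fromℚᵘ-+ (mkℚᵘ (+ a) 0) (mkℚᵘ (+ b) 0)) (cong (_/ 1)
    (trans (cong₂ ℤ._+_ (ℤP.*-identityʳ (+ a)) (ℤP.*-identityʳ (+ b))) (sym (ℤP.pos-+ a b))))

  ι-* : ∀ a b → ι a ℚ.* ι b ≡ ι (a ℕ.* b)
  ι-* a b = /-* a 0 b 0

  ι-∸ : ∀ x y {z} → x ℕ.+ y ≡ z → ι x ≡ ι z ℚ.- ι y
  ι-∸ x y refl = trans (sym (//-rightDividesʳ (ι y) (ι x))) (cong (ℚ._- ι y) (ι-+ x y))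

module DissectionNumbers where
  open import Defs
  open import Data.Nat as ℕ using (ℕ; zero; suc; _≤?_)
  import Data.Nat.Properties as ℕP
  open import Data.Nat.Combinatorics using (_C_; nCn≡1; nC1≡n)
  open import Data.Nat.Tactic.RingSolver using (solve-∀)
  open import Data.Integer as ℤ using (+_)
  open import Data.Rational as ℚ using (ℚ; _/_; 0ℚ)
  import Data.Rational.Properties as ℚP
  open import Data.List using (foldr; map; applyUpTo)
  open import Data.Empty using (⊥-elim)
  open import Relation.Nullary using (yes; no)
  open import Relation.Binary.PropositionalEquality
  open ≡-Reasoning
  open PowerSeries
  open Ballot
  open Binomials
  open NatToRational

  A-inside : ∀ m l → l ℕ.+ 3 ℕ.≤ m →
             A (+ m) (+ l) ≡ + ((((m ℕ.+ l) ℕ.∸ 1) C l) ℕ.* ((m ℕ.∸ 3) C l)) / suc l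
  A-inside m l l+3≤m with (l ℕ.+ 3) ≤? m
  ... | yes _    = refl
  ... | no l+3≰m = ⊥-elim (l+3≰m l+3≤m)

  -- A (3 + t) (t + 1) = 0: no (t+3)-gon has t + 1 non-crossing diagonals.
  A-overfull : ∀ t → A (+ (3 ℕ.+ t)) (+ suc t) ≡ 0ℚ
  A-overfull t with (suc t ℕ.+ 3) ≤? 3 ℕ.+ t
  ... | yes t+4≤t+3 = ⊥-elim (ℕP.<-irrefl (ℕP.+-comm t 3) t+4≤t+3)
  ... | no _        = refl

  central-binomial : ∀ k → (2 ℕ.* k) C k ≡ E 0 k
  central-binomial k = cong (λ n → (k ℕ.+ n) C k) (ℕP.+-identityʳ k)

  Cat-cat : ∀ k → Cat (+ k) ≡ ι (cat k)
  Cat-cat zero    = refl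
  Cat-cat (suc j) = /-cross ((2 ℕ.* suc j) C suc j) (suc j) (cat (suc j)) 0 (begin
    ((2 ℕ.* suc j) C suc j) ℕ.* 1 ≡⟨ ℕP.*-identityʳ _ ⟩
    (2 ℕ.* suc j) C suc j         ≡⟨ central-binomial (suc j) ⟩
    E 0 (suc j)                   ≡⟨ sym (catalan-binomial j) ⟩
    cat (suc j) ℕ.* suc (suc j) ∎)

  triangulations : ∀ t → A (+ (3 ℕ.+ t)) (+ t) ≡ Cat (+ suc t)
  triangulations t = trans (A-inside (3 ℕ.+ t) t (ℕP.≤-reflexive (ℕP.+-comm t 3)))
    (/-cross (E 2 t ℕ.* (t C t)) t ((2 ℕ.* suc t) C suc t) (suc t) (begin
      E 2 t ℕ.* (t C t) ℕ.* suc (suc t) ≡⟨ cong (λ x → E 2 t ℕ.* x ℕ.* suc (suc t)) (nCn≡1 t) ⟩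
      E 2 t ℕ.* 1 ℕ.* suc (suc t)       ≡⟨ cong (ℕ._* suc (suc t)) (ℕP.*-identityʳ (E 2 t)) ⟩
      E 2 t ℕ.* suc (suc t)             ≡⟨ E-ratio 0 t ⟩
      E 0 (suc t) ℕ.* suc t             ≡⟨ cong (ℕ._* suc t) (sym (central-binomial (suc t))) ⟩
      ((2 ℕ.* suc t) C suc t) ℕ.* suc t ∎))

  near-triangulations : ∀ t → A (+ (4 ℕ.+ t)) (+ t) ≡ ι (E 3 t)
  near-triangulations t = trans (A-inside (4 ℕ.+ t) t (ℕP.≤-trans (ℕP.≤-reflexive (ℕP.+-comm t 3)) (ℕP.n≤1+n _)))
    (/-cross (E 3 t ℕ.* (suc t C t)) t (E 3 t) 0 (begin
      E 3 t ℕ.* (suc t C t) ℕ.* 1 ≡⟨ ℕP.*-identityʳ _ ⟩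
      E 3 t ℕ.* (suc t C t)       ≡⟨ cong (E 3 t ℕ.*_) [1+t]Ct≡1+t ⟩
      E 3 t ℕ.* suc t ∎))
    where
    [1+t]Ct≡1+t : suc t C t ≡ suc t
    [1+t]Ct≡1+t = begin
      suc t C t         ≡⟨ cong (_C t) (ℕP.+-comm 1 t) ⟩
      (t ℕ.+ 1) C t     ≡⟨ symmetry t 1 ⟩
      (t ℕ.+ 1) C 1     ≡⟨ nC1≡n (t ℕ.+ 1) ⟩
      t ℕ.+ 1           ≡⟨ ℕP.+-comm t 1 ⟩
      suc t ∎

  -- The coefficient sequences i ↦ A^(i+1)_(i-2) and j ↦ A^(j+1)_(j-3), as
  -- power series: tri = x (c - 1) and nearTri = x³ c³/√(1 - 4x).
  tri : ℕ → ℕ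
  tri = shift (shift cat⁺)

  nearTri : ℕ → ℕ
  nearTri = shift (shift (shift (E 3)))

  A-tri : ∀ i → A (+ i ℤ.+ + 1) (+ i ℤ.- + 2) ≡ ι (tri i)
  A-tri zero          = refl
  A-tri (suc zero)    = refl
  A-tri (suc (suc t)) = begin
    A (+ (2 ℕ.+ t ℕ.+ 1)) (+ t) ≡⟨ cong (λ m → A (+ m) (+ t)) (ℕP.+-comm (2 ℕ.+ t) 1) ⟩
    A (+ (3 ℕ.+ t)) (+ t)       ≡⟨ triangulations t ⟩
    Cat (+ suc t)               ≡⟨ Cat-cat (suc t) ⟩
    ι (cat (suc t)) ∎

  A-nearTri : ∀ j → A (+ j ℤ.+ + 1) (+ j ℤ.- + 3) ≡ ι (nearTri j)
  A-nearTri zero                = refl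
  A-nearTri (suc zero)          = refl
  A-nearTri (suc (suc zero))    = refl
  A-nearTri (suc (suc (suc t))) = begin
    A (+ (3 ℕ.+ t ℕ.+ 1)) (+ t) ≡⟨ cong (λ m → A (+ m) (+ t)) (ℕP.+-comm (3 ℕ.+ t) 1) ⟩
    A (+ (4 ℕ.+ t)) (+ t)       ≡⟨ near-triangulations t ⟩
    ι (E 3 t) ∎

  -- Σ_{i+j=n} tri i tri j = C_(n-1) - 2 C_(n-2), in the form valid in ℕ.
  tri-square : ∀ m → conv tri tri (4 ℕ.+ m) ℕ.+ (cat (2 ℕ.+ m) ℕ.+ cat (2 ℕ.+ m)) ≡ cat (3 ℕ.+ m)
  tri-square m = begin
    conv tri tri (4 ℕ.+ m) ℕ.+ (c ℕ.+ c)          ≡⟨⟩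
    conv cat⁺ tri (2 ℕ.+ m) ℕ.+ (c ℕ.+ c)         ≡⟨ cong (ℕ._+ (c ℕ.+ c)) (conv-comm cat⁺ tri (2 ℕ.+ m)) ⟩
    conv cat⁺ cat⁺ m ℕ.+ (c ℕ.+ c)                ≡⟨ rearrange (conv cat⁺ cat⁺ m) c ⟩
    1 ℕ.* c ℕ.+ (1 ℕ.* c ℕ.+ conv cat⁺ cat⁺ m)    ≡⟨⟩
    1 ℕ.* c ℕ.+ conv cat cat⁺ (1 ℕ.+ m)           ≡⟨ cong (1 ℕ.* c ℕ.+_) (conv-comm cat cat⁺ (1 ℕ.+ m)) ⟩
    1 ℕ.* c ℕ.+ conv cat⁺ cat (1 ℕ.+ m)           ≡⟨⟩
    conv cat cat (2 ℕ.+ m)                       ≡⟨ segner (2 ℕ.+ m) ⟩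
    cat (3 ℕ.+ m) ∎
    where
    c = cat (2 ℕ.+ m)
    rearrange : ∀ x c → x ℕ.+ (c ℕ.+ c) ≡ 1 ℕ.* c ℕ.+ (1 ℕ.* c ℕ.+ x)
    rearrange = solve-∀

  tri-nearTri : ∀ m → conv tri nearTri (5 ℕ.+ m) ≡ E 5 m
  tri-nearTri m = begin
    conv tri nearTri (5 ℕ.+ m)    ≡⟨⟩
    conv cat⁺ nearTri (3 ℕ.+ m)   ≡⟨ conv-comm cat⁺ nearTri (3 ℕ.+ m) ⟩
    conv nearTri cat⁺ (3 ℕ.+ m)   ≡⟨⟩
    conv (E 3) cat⁺ m             ≡⟨ conv-comm (E 3) cat⁺ m ⟩
    conv cat⁺ (E 3) m             ≡⟨ conv-cat⁺-E 3 m ⟩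
    E 5 m ∎

  sum-ι : ∀ (g : ℕ → ℕ) m (h : ℕ → ℚ) F → (∀ i → h (g i) ≡ ι (F i)) →
          foldr ℚ._+_ 0ℚ (map h (applyUpTo g m)) ≡ ι (S F m)
  sum-ι g zero    h F h∘g≡ιF = refl
  sum-ι g (suc m) h F h∘g≡ιF = trans
    (cong₂ ℚ._+_ (h∘g≡ιF 0) (sum-ι (λ i → g (suc i)) m h (λ i → F (suc i)) (λ i → h∘g≡ιF (suc i))))
    (ι-+ (F 0) _)

  sumPairs-conv : ∀ n f a b → (∀ i j → f i j ≡ ι (a i ℕ.* b j)) → sumPairs n f ≡ ι (conv a b n)
  sumPairs-conv n f a b f≡ιab =
    sum-ι (λ i → i) (suc n) (λ i → f i (n ℕ.∸ i)) (λ i → a i ℕ.* b (n ℕ.∸ i)) (λ i → f≡ιab i (n ℕ.∸ i))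

  sumPairs-at-one : ∀ n f → (∀ j → f 0 j ≡ 0ℚ) → (∀ i j → f (2 ℕ.+ i) j ≡ 0ℚ) → sumPairs (suc n) f ≡ f 1 n
  sumPairs-at-one n f f₀≡0 f₂₊≡0 = begin
    f 0 (suc n) ℚ.+ (f 1 n ℚ.+ rest)  ≡⟨ cong₂ (λ x y → x ℚ.+ (f 1 n ℚ.+ y)) (f₀≡0 (suc n)) rest≡0 ⟩
    0ℚ ℚ.+ (f 1 n ℚ.+ 0ℚ)             ≡⟨ ℚP.+-identityˡ _ ⟩
    f 1 n ℚ.+ 0ℚ                      ≡⟨ ℚP.+-identityʳ (f 1 n) ⟩
    f 1 n ∎
    where
    rest = foldr ℚ._+_ 0ℚ (map (λ i → f i (suc n ℕ.∸ i)) (applyUpTo (λ i → 2 ℕ.+ i) n))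
    rest≡0 : rest ≡ 0ℚ
    rest≡0 = trans (sum-ι (λ i → 2 ℕ.+ i) n (λ i → f i (suc n ℕ.∸ i)) (λ _ → 0) (λ i → f₂₊≡0 i _))
                   (cong ι (S-zero n))

open import Defs
open import Data.Nat using (ℕ; _≤_)
open import Data.Integer using (+_; _+_; _-_)
open import Data.Rational using (ℚ) renaming (_+_ to _+ℚ_; _*_ to _*ℚ_; _-_ to _-ℚ_)
open import Data.Product using (_×_; _,_)
open import Relation.Binary.PropositionalEquality using (_≡_)

module Identities where
  open import Data.Nat as ℕ using (zero; suc; s≤s)
  import Data.Nat.Properties as ℕP
  open import Data.Rational using (0ℚ; 1ℚ; _/_)
  import Data.Rational.Properties as ℚP
  open import Data.Nat.Combinatorics using (_C_)
  open import Relation.Binary.PropositionalEquality using (refl; sym; trans; cong; cong₂; module ≡-Reasoning)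
  open ≡-Reasoning
  open PowerSeries using (conv)
  open Ballot using (cat)
  open Binomials using (E; E5-central)
  open NatToRational
  open DissectionNumbers

  summand₃ summand₄ : ℕ → ℕ → ℚ
  summand₃ i j = A (+ i + + 1) (+ i - + 2) *ℚ A (+ j + + 1) (+ j - + 2)
  summand₄ i j = A (+ i + + 1) (+ i - + 2) *ℚ A (+ j + + 1) (+ j - + 3)

  A-tri² : ∀ i j → summand₃ i j ≡ ι (tri i ℕ.* tri j)
  A-tri² i j = trans (cong₂ _*ℚ_ (A-tri i) (A-tri j)) (ι-* (tri i) (tri j))

  A-tri-nearTri : ∀ i j → summand₄ i j ≡ ι (tri i ℕ.* nearTri j)
  A-tri-nearTri i j = trans (cong₂ _*ℚ_ (A-tri i) (A-nearTri j)) (ι-* (tri i) (nearTri j))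

  part1 : (n : ℕ) → 2 ≤ n → A (+ n) (+ n - + 3) +ℚ A (+ n) (+ n - + 2) ≡ Cat (+ n - + 2)
  part1 (suc zero)          (s≤s ())
  part1 (suc (suc zero))    _ = refl
  part1 (suc (suc (suc t))) _ = begin
    A (+ (3 ℕ.+ t)) (+ t) +ℚ A (+ (3 ℕ.+ t)) (+ suc t) ≡⟨ cong₂ _+ℚ_ (triangulations t) (A-overfull t) ⟩
    Cat (+ suc t) +ℚ 0ℚ                                ≡⟨ ℚP.+-identityʳ _ ⟩
    Cat (+ suc t) ∎

  -- (2) Only i = 1 contributes, with A^2_0 = 1.
  part2 : (n q : ℕ) → 2 ≤ n → 2 ≤ q →
    sumPairs n (λ i j → A (+ i + + 1) (+ i - + 1) *ℚ A (+ j + + 1) (+ j + + 1 - + q))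
      ≡ A (+ n) (+ n - + q)
  part2 (suc zero)    q (s≤s ()) _
  part2 (suc (suc n)) q _ _ = begin
    sumPairs (suc (suc n)) f                               ≡⟨ sumPairs-at-one (suc n) f (λ j → ℚP.*-zeroˡ (Y j)) vanish ⟩
    1ℚ *ℚ Y (suc n)                                        ≡⟨ ℚP.*-identityˡ (Y (suc n)) ⟩
    A (+ (suc n ℕ.+ 1)) (+ (suc n ℕ.+ 1) - + q)            ≡⟨ cong (λ m → A (+ m) (+ m - + q)) (ℕP.+-comm (suc n) 1) ⟩
    A (+ suc (suc n)) (+ suc (suc n) - + q) ∎
    where
    Y : ℕ → ℚ
    Y j = A (+ j + + 1) (+ j + + 1 - + q)
    f : ℕ → ℕ → ℚ
    f i j = A (+ i + + 1) (+ i - + 1) *ℚ Y j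
    vanish : ∀ i j → f (2 ℕ.+ i) j ≡ 0ℚ
    vanish i j = trans (cong (λ m → A (+ m) (+ suc i) *ℚ Y j) (ℕP.+-comm (2 ℕ.+ i) 1))
                       (trans (cong (_*ℚ Y j) (A-overfull i)) (ℚP.*-zeroˡ (Y j)))

  -- (3) The Catalan recurrence with the two boundary terms removed; the case
  -- n = 3 (both sides 0) is checked by computation.
  part3 : (n : ℕ) → 3 ≤ n →
    sumPairs n (λ i j → A (+ i + + 1) (+ i - + 2) *ℚ A (+ j + + 1) (+ j - + 2))
      ≡ Cat (+ n - + 1) -ℚ (Cat (+ n - + 2) +ℚ Cat (+ n - + 2))
  part3 (suc zero)             (s≤s ())
  part3 (suc (suc zero))       (s≤s (s≤s ()))
  part3 (suc (suc (suc zero))) _ = trans (sumPairs-conv 3 _ tri tri A-tri²) refl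
  part3 (suc (suc (suc (suc m)))) _ = begin
    sumPairs (4 ℕ.+ m) summand₃                  ≡⟨ sumPairs-conv (4 ℕ.+ m) _ tri tri A-tri² ⟩
    ι (conv tri tri (4 ℕ.+ m))                   ≡⟨ ι-∸ (conv tri tri (4 ℕ.+ m)) (c ℕ.+ c) (tri-square m) ⟩
    ι (cat (3 ℕ.+ m)) -ℚ ι (c ℕ.+ c)             ≡⟨ cong₂ _-ℚ_ (sym (Cat-cat (3 ℕ.+ m))) (sym (ι-+ c c)) ⟩
    Cat (+ (3 ℕ.+ m)) -ℚ (ι c +ℚ ι c)            ≡⟨ cong (λ x → Cat (+ (3 ℕ.+ m)) -ℚ (x +ℚ x)) (sym (Cat-cat (2 ℕ.+ m))) ⟩
    Cat (+ (3 ℕ.+ m)) -ℚ (Cat (+ (2 ℕ.+ m)) +ℚ Cat (+ (2 ℕ.+ m))) ∎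
    where
    c = cat (2 ℕ.+ m)

  -- (4) The convolution x(c - 1) · x³c³/√(1 - 4x) = x⁵c⁵/√(1 - 4x), whose
  -- coefficient binom(2n - 5, n - 5) is compared with the closed form, where
  -- coef4 (m + 5) computes to (m + 2)(m + 1)/(2(m + 5)).
  part4 : (n : ℕ) → 3 ≤ n →
    sumPairs n (λ i j → A (+ i + + 1) (+ i - + 2) *ℚ A (+ j + + 1) (+ j - + 3))
      ≡ coef4 n *ℚ Cat (+ n - + 2)
  part4 (suc zero)                   (s≤s ())
  part4 (suc (suc zero))             (s≤s (s≤s ()))
  part4 (suc (suc (suc zero)))       _ = trans (sumPairs-conv 3 _ tri nearTri A-tri-nearTri) refl
  part4 (suc (suc (suc (suc zero)))) _ = trans (sumPairs-conv 4 _ tri nearTri A-tri-nearTri) refl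
  part4 (suc (suc (suc (suc (suc m))))) _ = begin
    sumPairs (5 ℕ.+ m) summand₄             ≡⟨ sumPairs-conv (5 ℕ.+ m) _ tri nearTri A-tri-nearTri ⟩
    ι (conv tri nearTri (5 ℕ.+ m))          ≡⟨ cong ι (tri-nearTri m) ⟩
    ι (E 5 m)                               ≡⟨ /-cross (E 5 m) 0 (a ℕ.* b) _ cross ⟩
    + (a ℕ.* b) / (2 ℕ.* (5 ℕ.+ m) ℕ.* (4 ℕ.+ m)) ≡⟨ sym (/-* a _ b (3 ℕ.+ m)) ⟩
    coef4 (5 ℕ.+ m) *ℚ Cat (+ (3 ℕ.+ m)) ∎
    where
    a = (2 ℕ.+ m) ℕ.* (1 ℕ.+ m)
    b = (2 ℕ.* (3 ℕ.+ m)) C (3 ℕ.+ m)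
    cross : E 5 m ℕ.* (2 ℕ.* (5 ℕ.+ m) ℕ.* (4 ℕ.+ m)) ≡ a ℕ.* b ℕ.* 1
    cross = begin
      E 5 m ℕ.* (2 ℕ.* (5 ℕ.+ m) ℕ.* (4 ℕ.+ m)) ≡⟨ E5-central m ⟩
      a ℕ.* E 0 (3 ℕ.+ m)                       ≡⟨ cong (a ℕ.*_) (sym (central-binomial (3 ℕ.+ m))) ⟩
      a ℕ.* b                                   ≡⟨ sym (ℕP.*-identityʳ (a ℕ.* b)) ⟩
      a ℕ.* b ℕ.* 1 ∎

lemma28 : ((n : ℕ) → 2 ≤ n → A (+ n) (+ n - + 3) +ℚ A (+ n) (+ n - + 2) ≡ Cat (+ n - + 2))
        × ((n q : ℕ) → 2 ≤ n → 2 ≤ q →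
             sumPairs n (λ i j → A (+ i + + 1) (+ i - + 1) *ℚ A (+ j + + 1) (+ j + + 1 - + q))
               ≡ A (+ n) (+ n - + q))
        × ((n : ℕ) → 3 ≤ n →
             sumPairs n (λ i j → A (+ i + + 1) (+ i - + 2) *ℚ A (+ j + + 1) (+ j - + 2))
               ≡ Cat (+ n - + 1) -ℚ (Cat (+ n - + 2) +ℚ Cat (+ n - + 2)))
        × ((n : ℕ) → 3 ≤ n →
             sumPairs n (λ i j → A (+ i + + 1) (+ i - + 2) *ℚ A (+ j + + 1) (+ j - + 3))
               ≡ coef4 n *ℚ Cat (+ n - + 2))
lemma28 = part1 , part2 , part3 , part4
  where open Identities
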